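{- Let $t\in\mathbb{N}$. There are constants $C_t$ and $N_t$ depending only on $t$ such that the following holds for $n\ge N_t$. Let $x_1,\dots,x_t\in\{0,1\}^{2n}$ be such that every atom of the Boolean algebra of subsets of $[2n]$ generated by $\mathrm{supp}(x_1),\dots,\mathrm{supp}(x_t)$ has at least $n/2^{t+1}$ elements, and let $Z\subseteq\mathrm{Span}(x_1,\dots,x_t)$. Then \[ \Pr_x\big[x\oplus z\in\mathcal{U}_{2n}\text{ for all }z\in Z\big]\leq n^{ -|Z|/2}(\log n)^{C_t}, \] where $x$ is uniform in $\{0,1\}^{2n}$.
   Context: $\mathcal{U}_{2n}=\{y\in\{0,1\}^{2n}:|y|=n\}$ with $|y|$ the Hamming weight; $\oplus$ is coordinatewise addition mod 2; $\mathrm{supp}(y)=\{i:y_i=1\}$; $\mathrm{Span}$ is the $\mathbb{F}_2$-linear span in $\mathbb{F}_2^{2n}$; $|Z|$ is the cardinality of $Z$. The atoms of the algebra are the $2^t$ sets $\bigcap_{i=1}^tA_i$ with each $A_i\in\{\mathrm{supp}(x_i),[2n]\setminus\mathrm{supp}(x_i)\}$. -}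

module Defs where

open import Data.Nat using (ℕ; zero; suc; _+_; _≡ᵇ_)
open import Data.Bool using (Bool; true; false; _xor_; not; _∧_; if_then_else_)
open import Data.Fin using (Fin; zero; suc)
open import Data.Vec using (Vec; []; _∷_; zipWith; replicate; lookup)
open import Data.List using (List; []; _∷_; map; _++_)
open import Data.Product using (∃)
open import Relation.Binary.PropositionalEquality using (_≡_)

weight : ∀ {m} → Vec Bool m → ℕ
weight [] = 0
weight (true ∷ v) = suc (weight v)
weight (false ∷ v) = weight v

_⊕_ : ∀ {m} → Vec Bool m → Vec Bool m → Vec Bool m
_⊕_ = zipWith _xor_

allVecs : (m : ℕ) → List (Vec Bool m)
allVecs zero = [] ∷ []
allVecs (suc m) = map (false ∷_) (allVecs m) ++ map (true ∷_) (allVecs m)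

countList : ∀ {A : Set} → (A → Bool) → List A → ℕ
countList p [] = 0
countList p (a ∷ as) = if p a then suc (countList p as) else countList p as

countFin : ∀ {m} → (Fin m → Bool) → ℕ
countFin {zero} p = 0
countFin {suc m} p = (if p zero then 1 else 0) + countFin {m} (λ i → p (suc i))

allFinB : ∀ {t} → (Fin t → Bool) → Bool
allFinB {zero} p = true
allFinB {suc t} p = p zero ∧ allFinB {t} (λ j → p (suc j))

allListB : ∀ {A : Set} → (A → Bool) → List A → Bool
allListB p [] = true
allListB p (a ∷ as) = p a ∧ allListB p as

eqB : Bool → Bool → Bool
eqB a b = not (a xor b)

-- Atom indexed by a sign pattern s : Fin t → Bool:
-- ⋂_j A_j with A_j = supp(x_j) if s j = true, complement otherwise.
-- i belongs to it iff (x_j)_i = s j for all j.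
atomSize : ∀ {t m} → (Fin t → Vec Bool m) → (Fin t → Bool) → ℕ
atomSize xs s = countFin (λ i → allFinB (λ j → eqB (lookup (xs j) i) (s j)))

linComb : ∀ {t m} → (Fin t → Vec Bool m) → (Fin t → Bool) → Vec Bool m
linComb {zero} xs c = replicate _ false
linComb {suc t} xs c =
  (if c zero then xs zero else replicate _ false) ⊕ linComb {t} (λ j → xs (suc j)) (λ j → c (suc j))

InSpan : ∀ {t m} → (Fin t → Vec Bool m) → Vec Bool m → Set
InSpan xs z = ∃ λ c → z ≡ linComb xs c

-- number of x ∈ {0,1}^{m} with x ⊕ z ∈ U_{2n} (i.e. weight n) for all z ∈ Z
goodCount : ∀ {m} → ℕ → List (Vec Bool m) → ℕ
goodCount {m} n Z = countList (λ x → allListB (λ z → weight (x ⊕ z) ≡ᵇ n) Z) (allVecs m)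

module Submission where

-- We bound, more generally, the number of x ∈ {0,1}^m satisfying any system of
-- constraints  weight (x ⊕ Σ_j c_j x_j) = β(c)  for c in a set κ of sign vectors, assuming
-- every atom has at least n/A elements: its square is at most (4A)^|κ| 4^m / n^|κ|.
-- For t = 0 there is at most one constraint, and binom(m,w)² m ≤ 4·4^m.
-- Otherwise split the coordinates into P = supp x₁ and Q = its complement, where x₁ is all
-- ones and all zeros respectively. Writing x = (u, v), the constraints for (0,c) and (1,c) read
--   w_P + w_Q = β(0,c)   and   (|P| − w_P) + w_Q = β(1,c),
-- with w_P = weight (u ⊕ Σ_{j≥2} c_j x_j|P) and w_Q = weight (v ⊕ Σ_{j≥2} c_j x_j|Q). If both hold
-- they fix w_Q, and once v is known either one fixes w_P. Hence v solves a system on Q with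
-- constraint set κ∧ and, for each such v, u solves a system on P with constraint set κ∨, where
-- |κ∧| + |κ∨| = |κ|; the atoms of x₂,…,x_t restricted to P or to Q are atoms of x₁,…,x_t, so
-- induction applies to both. The theorem is the case where κ is Z (as sign vectors), β ≡ n,
-- m = 2n and A = 2^(t+1); as |Z| ≤ 2^t the constant depends only on t, and the power of
-- log n merely absorbs it.

open import Defs
open import Data.Nat using (ℕ; suc; _*_; _^_; _≤_)
open import Data.Nat.Logarithm using (⌊log₂_⌋)
open import Data.Bool using (Bool)
open import Data.Fin using (Fin)
open import Data.Vec using (Vec)
open import Data.List using (List; length)
open import Data.List.Relation.Unary.All using (All)
open import Data.List.Relation.Unary.Unique.Propositional using (Unique)
open import Data.Product using (∃-syntax)

open import Data.Nat
open import Data.Nat.Properties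
open import Data.Nat.Logarithm using (⌊log₂⌋-mono-≤; ⌊log₂[2^n]⌋≡n)
open import Data.Nat.Tactic.RingSolver using (solve-∀)
open import Data.Bool using (true; false; T; _∧_; _∨_; if_then_else_)
open import Data.Bool.Properties
  using (T-∧; T-∨; xor-identityˡ; xor-identityʳ; if-float; if-cong-else) renaming (_≟_ to _≟ᵇ_)
open import Data.Bool.ListAction using (any)
open import Data.Empty using (⊥-elim)
open import Data.Fin using (zero; suc)
open import Data.Vec using ([]; _∷_; replicate; tabulate; lookup; head; tail)
open import Data.Vec.Properties using (≡-dec; zipWith-identityˡ; zipWith-identityʳ)
open import Data.Vec.Functional using () renaming ([] to []ᶠ; _∷_ to _∷ᶠ_)
open import Data.List using ([]; _∷_; map; _++_)
open import Data.List.Relation.Unary.All using ([]; _∷_)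
open import Data.List.Relation.Unary.AllPairs using ([]; _∷_)
open import Data.Product using (∃; _×_; _,_; proj₁; proj₂)
open import Data.Sum using (inj₁; inj₂)
open import Function using (_∘_; Equivalence)
open import Relation.Nullary using (Dec; yes; no; does)
open import Relation.Nullary.Decidable using (dec-true; dec-false)
open import Relation.Binary.Definitions using (DecidableEquality)
open import Relation.Binary.PropositionalEquality

open Equivalence using (to; from)

-- Binomial coefficients

sq : ℕ → ℕ
sq x = x * x

sq-mono-≤ : ∀ {x y} → x ≤ y → sq x ≤ sq y
sq-mono-≤ x≤y = *-mono-≤ x≤y x≤y

2^m*2^m≡4^m : ∀ m → 2 ^ m * 2 ^ m ≡ 4 ^ m
2^m*2^m≡4^m zero    = refl
2^m*2^m≡4^m (suc m) = trans (regroup (2 ^ m)) (cong (4 *_) (2^m*2^m≡4^m m))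
  where
  regroup : ∀ a → 2 * a * (2 * a) ≡ 4 * (a * a)
  regroup = solve-∀

-- binom b c is the binomial coefficient (b + c choose b).
binom : ℕ → ℕ → ℕ
binom zero    c       = 1
binom (suc b) zero    = 1
binom (suc b) (suc c) = binom (suc b) c + binom b (suc c)

binom-zeroʳ : ∀ b → binom b 0 ≡ 1
binom-zeroʳ zero    = refl
binom-zeroʳ (suc b) = refl

binom-sym : ∀ b c → binom b c ≡ binom c b
binom-sym zero    zero    = refl
binom-sym zero    (suc c) = refl
binom-sym (suc b) zero    = refl
binom-sym (suc b) (suc c) =
  trans (cong₂ _+_ (binom-sym (suc b) c) (binom-sym b (suc c)))
        (+-comm (binom c (suc b)) (binom (suc c) b))

binom-sucˡ : ∀ b c → suc b * binom (suc b) c ≡ (suc b + c) * binom b c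
binom-sucˡ b zero rewrite binom-zeroʳ b | +-identityʳ b = refl
binom-sucˡ zero (suc c) = begin
  binom 1 (suc c) + 0        ≡⟨ +-identityʳ _ ⟩
  binom 1 c + 1              ≡⟨ cong (_+ 1) (trans (sym (+-identityʳ _)) (binom-sucˡ zero c)) ⟩
  (suc c) * 1 + 1            ≡⟨ shift c ⟩
  (suc (suc c)) * 1          ∎
  where
  open ≡-Reasoning
  shift : ∀ c → (1 + c) * 1 + 1 ≡ (2 + c) * 1
  shift = solve-∀
binom-sucˡ (suc b) (suc c) = begin
  (2 + b) * (Z + (X + Y))                          ≡⟨ split-off b X Y Z ⟩
  (2 + b) * Z + (1 + b) * (X + Y) + (X + Y)        ≡⟨ cong₂ (λ u v → u + v + (X + Y)) (binom-sucˡ (suc b) c) (binom-sucˡ b (suc c)) ⟩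
  (2 + b + c) * X + (1 + b + (1 + c)) * Y + (X + Y) ≡⟨ collect b c X Y ⟩
  (2 + b + (1 + c)) * (X + Y)                      ∎
  where
  open ≡-Reasoning
  X = binom (suc b) c
  Y = binom b (suc c)
  Z = binom (suc (suc b)) c
  split-off : ∀ b X Y Z → (2 + b) * (Z + (X + Y)) ≡ (2 + b) * Z + (1 + b) * (X + Y) + (X + Y)
  split-off = solve-∀
  collect : ∀ b c X Y → (2 + b + c) * X + (1 + b + (1 + c)) * Y + (X + Y) ≡ (2 + b + (1 + c)) * (X + Y)
  collect = solve-∀

binom-sucʳ : ∀ b c → suc c * binom b (suc c) ≡ (b + suc c) * binom b c
binom-sucʳ b c = begin
  suc c * binom b (suc c)  ≡⟨ cong (suc c *_) (binom-sym b (suc c)) ⟩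
  suc c * binom (suc c) b  ≡⟨ binom-sucˡ c b ⟩
  (suc c + b) * binom c b  ≡⟨ cong₂ _*_ (+-comm (suc c) b) (binom-sym c b) ⟩
  (b + suc c) * binom b c  ∎
  where open ≡-Reasoning

binom-step-to-centre : ∀ b c → b ≤ c → binom b (suc c) ≤ binom (suc b) c
binom-step-to-centre b c b≤c = *-cancelˡ-≤ (suc b) (begin
  suc b * binom b (suc c)      ≤⟨ *-monoˡ-≤ (binom b (suc c)) (s≤s b≤c) ⟩
  suc c * binom b (suc c)      ≡⟨ binom-sucʳ b c ⟩
  (b + suc c) * binom b c      ≡⟨ cong (_* binom b c) (+-suc b c) ⟩
  (suc b + c) * binom b c      ≡⟨ binom-sucˡ b c ⟨
  suc b * binom (suc b) c      ∎)
  where open ≤-Reasoning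

binom-central : ∀ j → binom (suc j) (suc j) ≡ 2 * binom j (suc j)
binom-central j = *-cancelˡ-≡ _ _ (suc j) (begin
  suc j * binom (suc j) (suc j)       ≡⟨ binom-sucˡ j (suc j) ⟩
  (suc j + suc j) * binom j (suc j)   ≡⟨ regroup j (binom j (suc j)) ⟩
  suc j * (2 * binom j (suc j))       ∎)
  where
  open ≡-Reasoning
  regroup : ∀ j y → ((1 + j) + (1 + j)) * y ≡ (1 + j) * (2 * y)
  regroup = solve-∀

binom-central-suc : ∀ j → suc j * binom (suc j) (suc j) ≡ 2 * ((j + suc j) * binom j j)
binom-central-suc j = begin
  suc j * binom (suc j) (suc j)     ≡⟨ cong (suc j *_) (binom-central j) ⟩
  suc j * (2 * binom j (suc j))     ≡⟨ *-comm (suc j) _ ⟩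
  2 * binom j (suc j) * suc j       ≡⟨ *-assoc 2 (binom j (suc j)) (suc j) ⟩
  2 * (binom j (suc j) * suc j)     ≡⟨ cong (2 *_) (trans (*-comm _ (suc j)) (binom-sucʳ j j)) ⟩
  2 * ((j + suc j) * binom j j)     ∎
  where open ≡-Reasoning

binom-central-bound : ∀ j → sq (binom j j) * (3 * j + 1) ≤ 4 ^ (j + j)
binom-central-bound zero    = ≤-refl
binom-central-bound (suc j) = *-cancelˡ-≤ (sq (suc j)) (begin
  sq (suc j) * (sq d * (3 * suc j + 1))                   ≡⟨ regroup j d ⟩
  sq (suc j * d) * (3 * suc j + 1)                        ≡⟨ cong (λ D → sq D * (3 * suc j + 1)) (binom-central-suc j) ⟩
  sq (2 * ((j + suc j) * c)) * (3 * suc j + 1)            ≤⟨ m≤m+n _ (4 * sq c * j) ⟩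
  sq (2 * ((j + suc j) * c)) * (3 * suc j + 1) + 4 * sq c * j ≡⟨ expand j c ⟩
  16 * (sq c * (3 * j + 1)) * sq (suc j)                  ≤⟨ *-monoˡ-≤ (sq (suc j)) (*-monoʳ-≤ 16 (binom-central-bound j)) ⟩
  16 * 4 ^ (j + j) * sq (suc j)                           ≡⟨ cong (_* sq (suc j)) (four-steps j) ⟩
  4 ^ (suc j + suc j) * sq (suc j)                        ≡⟨ *-comm _ (sq (suc j)) ⟩
  sq (suc j) * 4 ^ (suc j + suc j)                        ∎)
  where
  open ≤-Reasoning
  c = binom j j
  d = binom (suc j) (suc j)
  regroup : ∀ a y → ((1 + a) * (1 + a)) * ((y * y) * (3 * (1 + a) + 1))
                  ≡ (((1 + a) * y) * ((1 + a) * y)) * (3 * (1 + a) + 1)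
  regroup = solve-∀
  expand : ∀ a y → ((2 * ((a + (1 + a)) * y)) * (2 * ((a + (1 + a)) * y))) * (3 * (1 + a) + 1) + 4 * (y * y) * a
                 ≡ 16 * ((y * y) * (3 * a + 1)) * ((1 + a) * (1 + a))
  expand = solve-∀
  four-steps : ∀ j → 16 * 4 ^ (j + j) ≡ 4 ^ (suc j + suc j)
  four-steps j = trans (*-assoc 4 4 (4 ^ (j + j))) (cong (λ k → 4 * 4 ^ k) (sym (+-suc j j)))

binom-bound-from-diagonal : ∀ d b → sq (binom b (b + d)) * (b + (b + d)) ≤ 4 * 4 ^ (b + (b + d))
binom-bound-from-diagonal zero b rewrite +-identityʳ b = begin
  sq (binom b b) * (b + b)        ≤⟨ *-monoʳ-≤ (sq (binom b b)) (b+b≤3b+1 b) ⟩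
  sq (binom b b) * (3 * b + 1)    ≤⟨ binom-central-bound b ⟩
  4 ^ (b + b)                     ≤⟨ m≤n*m _ 4 ⟩
  4 * 4 ^ (b + b)                 ∎
  where
  open ≤-Reasoning
  b+b≤3b+1 : ∀ b → b + b ≤ 3 * b + 1
  b+b≤3b+1 b = ≤-trans (m≤m+n (b + b) (b + 1)) (≤-reflexive (regroup b))
    where
    regroup : ∀ b → b + b + (b + 1) ≡ 3 * b + 1
    regroup = solve-∀
binom-bound-from-diagonal (suc zero) b rewrite +-comm b 1 =
  ≤-trans (*-cancelˡ-≤ 4 (begin
    4 * (sq y * (b + suc b))                     ≡⟨ regroup y b ⟩
    sq (2 * y) * (b + suc b)                     ≡⟨ cong (λ z → sq z * (b + suc b)) (binom-central b) ⟨
    sq (binom (suc b) (suc b)) * (b + suc b)     ≤⟨ *-monoʳ-≤ (sq (binom (suc b) (suc b))) (b+1+b≤3[b+1]+1 b) ⟩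
    sq (binom (suc b) (suc b)) * (3 * suc b + 1) ≤⟨ binom-central-bound (suc b) ⟩
    4 ^ (suc b + suc b)                          ≡⟨⟩
    4 * 4 ^ (b + suc b)                          ∎))
  (m≤n*m (4 ^ (b + suc b)) 4)
  where
  open ≤-Reasoning
  y = binom b (suc b)
  regroup : ∀ y b → 4 * ((y * y) * (b + (1 + b))) ≡ ((2 * y) * (2 * y)) * (b + (1 + b))
  regroup = solve-∀
  b+1+b≤3[b+1]+1 : ∀ b → b + suc b ≤ 3 * suc b + 1
  b+1+b≤3[b+1]+1 b = ≤-trans (m≤m+n (b + suc b) (b + 3)) (≤-reflexive (regroup′ b))
    where
    regroup′ : ∀ b → b + (1 + b) + (b + 3) ≡ 3 * (1 + b) + 1
    regroup′ = solve-∀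
binom-bound-from-diagonal (suc (suc d)) b = begin
  sq (binom b (b + (2 + d))) * (b + (b + (2 + d)))
    ≡⟨ cong₂ (λ c s → sq (binom b c) * s) (shift₁ b d) (shift₂ b d) ⟩
  sq (binom b (2 + (b + d))) * (1 + b + (1 + b + d))
    ≤⟨ *-monoˡ-≤ _ (sq-mono-≤ (binom-step-to-centre b (suc (b + d)) (m≤n⇒m≤1+n (m≤m+n b d)))) ⟩
  sq (binom (1 + b) (1 + b + d)) * (1 + b + (1 + b + d))
    ≤⟨ binom-bound-from-diagonal d (suc b) ⟩
  4 * 4 ^ (1 + b + (1 + b + d))
    ≡⟨ cong (λ k → 4 * 4 ^ k) (shift₂ b d) ⟨
  4 * 4 ^ (b + (b + (2 + d)))
    ∎
  where
  open ≤-Reasoning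
  shift₁ : ∀ b d → b + (2 + d) ≡ 2 + (b + d)
  shift₁ = solve-∀
  shift₂ : ∀ b d → b + (b + (2 + d)) ≡ 1 + b + (1 + b + d)
  shift₂ = solve-∀

binom-bound-≤ : ∀ {b c} → b ≤ c → sq (binom b c) * (b + c) ≤ 4 * 4 ^ (b + c)
binom-bound-≤ {b} b≤c = subst (λ c → sq (binom b c) * (b + c) ≤ 4 * 4 ^ (b + c))
                              (m+[n∸m]≡n b≤c) (binom-bound-from-diagonal _ b)

binom-bound : ∀ b c → sq (binom b c) * (b + c) ≤ 4 * 4 ^ (b + c)
binom-bound b c with ≤-total b c
... | inj₁ b≤c = binom-bound-≤ b≤c
... | inj₂ c≤b = subst₂ (λ x s → sq x * s ≤ 4 * 4 ^ s) (binom-sym c b) (+-comm c b) (binom-bound-≤ c≤b)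

-- Sums over the Boolean cube

Signs : ℕ → Set
Signs t = Fin t → Bool

ind : Bool → ℕ
ind b = if b then 1 else 0

ind≤1 : ∀ b → ind b ≤ 1
ind≤1 true  = ≤-refl
ind≤1 false = z≤n

ind-mono : ∀ {a b} → (T a → T b) → ind a ≤ ind b
ind-mono {false}         _   = z≤n
ind-mono {true}  {true}  _   = ≤-refl
ind-mono {true}  {false} a⇒b = ⊥-elim (a⇒b _)

ind-≤-* : ∀ {a b c} → (T a → T b × T c) → ind a ≤ ind b * ind c
ind-≤-* {false}                 _     = z≤n
ind-≤-* {true}  {true}  {true}  _     = ≤-refl
ind-≤-* {true}  {false}         a⇒bc = ⊥-elim (proj₁ (a⇒bc _))
ind-≤-* {true}  {true}  {false} a⇒bc = ⊥-elim (proj₂ (a⇒bc _))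

_⇒ᵇ_ : Bool → Bool → Bool
false ⇒ᵇ _ = true
true  ⇒ᵇ b = b

⇒ᵇ-intro : ∀ {a b} → (T a → T b) → T (a ⇒ᵇ b)
⇒ᵇ-intro {false} _   = _
⇒ᵇ-intro {true}  a⇒b = a⇒b _

sumSigns : ∀ k → (Signs k → ℕ) → ℕ
sumSigns zero    f = f []ᶠ
sumSigns (suc k) f = sumSigns k (f ∘ (false ∷ᶠ_)) + sumSigns k (f ∘ (true ∷ᶠ_))

-- Sums over Vec Bool m unfold exactly like sums over sign vectors, so the
-- sumSigns lemmas below apply to them verbatim.
sumVec : ∀ m → (Vec Bool m → ℕ) → ℕ
sumVec m f = sumSigns m (f ∘ tabulate)

sumSigns-cong : ∀ k {f g : Signs k → ℕ} → (∀ c → f c ≡ g c) → sumSigns k f ≡ sumSigns k g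
sumSigns-cong zero    f≡g = f≡g []ᶠ
sumSigns-cong (suc k) f≡g = cong₂ _+_ (sumSigns-cong k (f≡g ∘ (false ∷ᶠ_))) (sumSigns-cong k (f≡g ∘ (true ∷ᶠ_)))

sumSigns-mono-≤ : ∀ k {f g : Signs k → ℕ} → (∀ c → f c ≤ g c) → sumSigns k f ≤ sumSigns k g
sumSigns-mono-≤ zero    f≤g = f≤g []ᶠ
sumSigns-mono-≤ (suc k) f≤g = +-mono-≤ (sumSigns-mono-≤ k (f≤g ∘ (false ∷ᶠ_))) (sumSigns-mono-≤ k (f≤g ∘ (true ∷ᶠ_)))

sumSigns-+ : ∀ k (f g : Signs k → ℕ) → sumSigns k (λ c → f c + g c) ≡ sumSigns k f + sumSigns k g
sumSigns-+ zero    f g = refl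
sumSigns-+ (suc k) f g =
  trans (cong₂ _+_ (sumSigns-+ k (f ∘ (false ∷ᶠ_)) (g ∘ (false ∷ᶠ_))) (sumSigns-+ k (f ∘ (true ∷ᶠ_)) (g ∘ (true ∷ᶠ_))))
        (+-interchange (sumSigns k (f ∘ (false ∷ᶠ_))) (sumSigns k (g ∘ (false ∷ᶠ_)))
                       (sumSigns k (f ∘ (true ∷ᶠ_))) (sumSigns k (g ∘ (true ∷ᶠ_))))
  where
  +-interchange : ∀ a b c d → (a + b) + (c + d) ≡ (a + c) + (b + d)
  +-interchange = solve-∀

sumSigns-*ˡ : ∀ k a (f : Signs k → ℕ) → sumSigns k (λ c → a * f c) ≡ a * sumSigns k f
sumSigns-*ˡ zero    a f = refl
sumSigns-*ˡ (suc k) a f =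
  trans (cong₂ _+_ (sumSigns-*ˡ k a _) (sumSigns-*ˡ k a _)) (sym (*-distribˡ-+ a _ _))

sumSigns-const : ∀ k a → sumSigns k (λ _ → a) ≡ 2 ^ k * a
sumSigns-const zero    a = sym (+-identityʳ a)
sumSigns-const (suc k) a = begin
  sumSigns k (λ _ → a) + sumSigns k (λ _ → a) ≡⟨ cong₂ _+_ (sumSigns-const k a) (sumSigns-const k a) ⟩
  2 ^ k * a + 2 ^ k * a                       ≡⟨ cong (2 ^ k * a +_) (+-identityʳ (2 ^ k * a)) ⟨
  2 * (2 ^ k * a)                             ≡⟨ *-assoc 2 (2 ^ k) a ⟨
  2 ^ suc k * a                               ∎
  where open ≡-Reasoning

-- Sign vectors are functions, so without extensionality f has to respect ≗.
sumSigns-term : ∀ k (f : Signs k → ℕ) → (∀ {c c′} → c ≗ c′ → f c ≡ f c′) →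
                ∀ c → f c ≤ sumSigns k f
sumSigns-term zero    f f-resp c = ≤-reflexive (f-resp (λ ()))
sumSigns-term (suc k) f f-resp c = begin
  f c                      ≡⟨ f-resp (λ { zero → refl ; (suc j) → refl }) ⟩
  f (c zero ∷ᶠ (c ∘ suc))  ≤⟨ by-head (c zero) ⟩
  sumSigns (suc k) f       ∎
  where
  open ≤-Reasoning
  ∷-cong : ∀ {b} {d d′ : Signs k} → d ≗ d′ → (b ∷ᶠ d) ≗ (b ∷ᶠ d′)
  ∷-cong d≗d′ zero    = refl
  ∷-cong d≗d′ (suc j) = d≗d′ j
  by-head : ∀ b → f (b ∷ᶠ (c ∘ suc)) ≤ sumSigns (suc k) f
  by-head false = ≤-trans (sumSigns-term k _ (f-resp ∘ ∷-cong) (c ∘ suc)) (m≤m+n _ _)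
  by-head true  = ≤-trans (sumSigns-term k _ (f-resp ∘ ∷-cong) (c ∘ suc)) (m≤n+m _ _)

allSigns : ∀ k → (Signs k → Bool) → Bool
allSigns zero    p = p []ᶠ
allSigns (suc k) p = allSigns k (p ∘ (false ∷ᶠ_)) ∧ allSigns k (p ∘ (true ∷ᶠ_))

allSigns-intro : ∀ k {p : Signs k → Bool} → (∀ c → T (p c)) → T (allSigns k p)
allSigns-intro zero    all-p = all-p []ᶠ
allSigns-intro (suc k) all-p =
  from T-∧ (allSigns-intro k (all-p ∘ (false ∷ᶠ_)) , allSigns-intro k (all-p ∘ (true ∷ᶠ_)))

allSigns-combine : ∀ k {p q r : Signs k → Bool} → (∀ c → T (p c) → T (q c) → T (r c)) →
                   T (allSigns k p) → T (allSigns k q) → T (allSigns k r)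
allSigns-combine zero    pq⇒r all-p all-q = pq⇒r []ᶠ all-p all-q
allSigns-combine (suc k) pq⇒r all-p all-q with to T-∧ all-p | to T-∧ all-q
... | p₀ , p₁ | q₀ , q₁ = from T-∧ ( allSigns-combine k (pq⇒r ∘ (false ∷ᶠ_)) p₀ q₀
                                   , allSigns-combine k (pq⇒r ∘ (true ∷ᶠ_)) p₁ q₁)

argmax : ∀ m (f : Vec Bool m → ℕ) → ∃ λ v → ∀ w → f w ≤ f v
argmax zero    f = [] , λ { [] → ≤-refl }
argmax (suc m) f with argmax m (f ∘ (false ∷_)) | argmax m (f ∘ (true ∷_))
... | v₀ , max₀ | v₁ , max₁ with ≤-total (f (false ∷ v₀)) (f (true ∷ v₁))
...   | inj₁ f₀≤f₁ = true ∷ v₁ , λ { (false ∷ w) → ≤-trans (max₀ w) f₀≤f₁ ; (true ∷ w) → max₁ w }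
...   | inj₂ f₁≤f₀ = false ∷ v₀ , λ { (false ∷ w) → max₀ w ; (true ∷ w) → ≤-trans (max₁ w) f₁≤f₀ }

countList-++ : ∀ {A : Set} (p : A → Bool) xs ys → countList p (xs ++ ys) ≡ countList p xs + countList p ys
countList-++ p []       ys = refl
countList-++ p (a ∷ xs) ys with p a
... | true  = cong suc (countList-++ p xs ys)
... | false = countList-++ p xs ys

countList-map : ∀ {A B : Set} (p : B → Bool) (g : A → B) xs → countList p (map g xs) ≡ countList (p ∘ g) xs
countList-map p g []       = refl
countList-map p g (a ∷ xs) with p (g a)
... | true  = cong suc (countList-map p g xs)
... | false = countList-map p g xs

countList-allVecs : ∀ m (p : Vec Bool m → Bool) → countList p (allVecs m) ≡ sumVec m (ind ∘ p)
countList-allVecs zero    p with p []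
... | true  = refl
... | false = refl
countList-allVecs (suc m) p = begin
  countList p (map (false ∷_) (allVecs m) ++ map (true ∷_) (allVecs m))
    ≡⟨ countList-++ p (map (false ∷_) (allVecs m)) _ ⟩
  countList p (map (false ∷_) (allVecs m)) + countList p (map (true ∷_) (allVecs m))
    ≡⟨ cong₂ _+_ (countList-map p _ (allVecs m)) (countList-map p _ (allVecs m)) ⟩
  countList (p ∘ (false ∷_)) (allVecs m) + countList (p ∘ (true ∷_)) (allVecs m)
    ≡⟨ cong₂ _+_ (countList-allVecs m _) (countList-allVecs m _) ⟩
  sumVec (suc m) (ind ∘ p) ∎
  where open ≡-Reasoning

countWeight : ℕ → ℕ → ℕ
countWeight m w = sumVec m (λ x → ind (weight x ≡ᵇ w))

countWeight-zero : ∀ m → countWeight m 0 ≡ 1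
countWeight-zero zero    = refl
countWeight-zero (suc m) = cong₂ _+_ (countWeight-zero m) (trans (sumSigns-const m 0) (*-zeroʳ (2 ^ m)))

m<w⇒countWeight≡0 : ∀ m w → m < w → countWeight m w ≡ 0
m<w⇒countWeight≡0 zero    (suc w) _         = refl
m<w⇒countWeight≡0 (suc m) (suc w) (s≤s m<w) =
  cong₂ _+_ (m<w⇒countWeight≡0 m (suc w) (m≤n⇒m≤1+n m<w)) (m<w⇒countWeight≡0 m w m<w)

countWeight-binom : ∀ b c → countWeight (b + c) b ≡ binom b c
countWeight-binom zero    c       = countWeight-zero c
countWeight-binom (suc b) zero    = cong₂ _+_ (m<w⇒countWeight≡0 (b + 0) (suc b) (s≤s (≤-reflexive (+-identityʳ b))))
                                              (trans (countWeight-binom b 0) (binom-zeroʳ b))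
countWeight-binom (suc b) (suc c) = cong₂ _+_ (trans (cong (λ m → countWeight m (suc b)) (+-suc b c)) (countWeight-binom (suc b) c))
                                              (countWeight-binom b (suc c))

countWeight-bound : ∀ m w → sq (countWeight m w) * m ≤ 4 * 4 ^ m
countWeight-bound m w with w ≤? m
... | yes w≤m = subst (λ m → sq (countWeight m w) * m ≤ 4 * 4 ^ m) (m+[n∸m]≡n w≤m)
                      (subst (λ x → sq x * (w + (m ∸ w)) ≤ 4 * 4 ^ (w + (m ∸ w)))
                             (sym (countWeight-binom w (m ∸ w))) (binom-bound w (m ∸ w)))
... | no  w≰m = subst (λ x → sq x * m ≤ 4 * 4 ^ m) (sym (m<w⇒countWeight≡0 m w (≰⇒> w≰m))) z≤n

-- Restriction to one side of a vector

⊕-identityˡ : ∀ {m} (y : Vec Bool m) → replicate m false ⊕ y ≡ y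
⊕-identityˡ = zipWith-identityˡ xor-identityˡ

⊕-identityʳ : ∀ {m} (y : Vec Bool m) → y ⊕ replicate m false ≡ y
⊕-identityʳ = zipWith-identityʳ xor-identityʳ

weight-⊕-complement : ∀ {m} (u L : Vec Bool m) → weight (u ⊕ (replicate m true ⊕ L)) + weight (u ⊕ L) ≡ m
weight-⊕-complement []          []          = refl
weight-⊕-complement (true ∷ u)  (true ∷ L)  = cong suc (weight-⊕-complement u L)
weight-⊕-complement (true ∷ u)  (false ∷ L) = trans (+-suc _ _) (cong suc (weight-⊕-complement u L))
weight-⊕-complement (false ∷ u) (true ∷ L)  = trans (+-suc _ _) (cong suc (weight-⊕-complement u L))
weight-⊕-complement (false ∷ u) (false ∷ L) = cong suc (weight-⊕-complement u L)

linComb-cong : ∀ {t m} (xs : Fin t → Vec Bool m) {c c′ : Signs t} → c ≗ c′ → linComb xs c ≡ linComb xs c′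
linComb-cong {zero}  xs c≗c′ = refl
linComb-cong {suc t} xs c≗c′ =
  cong₂ _⊕_ (cong (λ b → if b then xs zero else _) (c≗c′ zero)) (linComb-cong (xs ∘ suc) (c≗c′ ∘ suc))

part : ∀ {m} → Bool → Vec Bool m → ℕ
part b []      = 0
part b (a ∷ M) = if eqB a b then suc (part b M) else part b M

restrict : ∀ {m} (b : Bool) (M : Vec Bool m) → Vec Bool m → Vec Bool (part b M)
restrict b []      []      = []
restrict b (a ∷ M) (y ∷ x) with eqB a b
... | true  = y ∷ restrict b M x
... | false = restrict b M x

part-true+part-false : ∀ {m} (M : Vec Bool m) → part true M + part false M ≡ m
part-true+part-false []          = refl
part-true+part-false (true ∷ M)  = cong suc (part-true+part-false M)
part-true+part-false (false ∷ M) = trans (+-suc (part true M) (part false M)) (cong suc (part-true+part-false M))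

restrict-⊕ : ∀ {m} b (M x y : Vec Bool m) → restrict b M (x ⊕ y) ≡ restrict b M x ⊕ restrict b M y
restrict-⊕ b []      []      []      = refl
restrict-⊕ b (a ∷ M) (_ ∷ x) (_ ∷ y) with eqB a b
... | true  = cong (_ ∷_) (restrict-⊕ b M x y)
... | false = restrict-⊕ b M x y

restrict-replicate : ∀ {m} b (M : Vec Bool m) a → restrict b M (replicate m a) ≡ replicate (part b M) a
restrict-replicate b []      a = refl
restrict-replicate b (c ∷ M) a with eqB c b
... | true  = cong (a ∷_) (restrict-replicate b M a)
... | false = restrict-replicate b M a

restrict-self : ∀ {m} b (M : Vec Bool m) → restrict b M M ≡ replicate (part b M) b
restrict-self true  []          = refl
restrict-self true  (true ∷ M)  = cong (true ∷_) (restrict-self true M)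
restrict-self true  (false ∷ M) = restrict-self true M
restrict-self false []          = refl
restrict-self false (true ∷ M)  = restrict-self false M
restrict-self false (false ∷ M) = cong (false ∷_) (restrict-self false M)

weight-restrict : ∀ {m} (M y : Vec Bool m) → weight y ≡ weight (restrict true M y) + weight (restrict false M y)
weight-restrict []          []          = refl
weight-restrict (true ∷ M)  (true ∷ y)  = cong suc (weight-restrict M y)
weight-restrict (true ∷ M)  (false ∷ y) = weight-restrict M y
weight-restrict (false ∷ M) (true ∷ y)  = trans (cong suc (weight-restrict M y)) (sym (+-suc _ _))
weight-restrict (false ∷ M) (false ∷ y) = weight-restrict M y

sumVec-restrict : ∀ {m} (M : Vec Bool m) (g : Vec Bool (part true M) → Vec Bool (part false M) → ℕ) →
  sumVec m (λ x → g (restrict true M x) (restrict false M x))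
    ≡ sumVec (part false M) (λ v → sumVec (part true M) (λ u → g u v))
sumVec-restrict []          g = refl
sumVec-restrict (false ∷ M) g =
  cong₂ _+_ (sumVec-restrict M (λ u v → g u (false ∷ v))) (sumVec-restrict M (λ u v → g u (true ∷ v)))
sumVec-restrict (true ∷ M)  g =
  trans (cong₂ _+_ (sumVec-restrict M (λ u v → g (false ∷ u) v)) (sumVec-restrict M (λ u v → g (true ∷ u) v)))
        (sym (sumSigns-+ (part false M) _ _))

restrict-linComb : ∀ {t m} b (M : Vec Bool m) (xs : Fin t → Vec Bool m) c →
                   restrict b M (linComb xs c) ≡ linComb (restrict b M ∘ xs) c
restrict-linComb {zero}  b M xs c = restrict-replicate b M false
restrict-linComb {suc t} b M xs c = begin
  restrict b M ((if c zero then xs zero else replicate _ false) ⊕ linComb (xs ∘ suc) (c ∘ suc))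
    ≡⟨ restrict-⊕ b M _ _ ⟩
  restrict b M (if c zero then xs zero else replicate _ false) ⊕ restrict b M (linComb (xs ∘ suc) (c ∘ suc))
    ≡⟨ cong₂ _⊕_ (trans (if-float (restrict b M) (c zero)) (if-cong-else (c zero) (restrict-replicate b M false)))
                 (restrict-linComb b M (xs ∘ suc) (c ∘ suc)) ⟩
  (if c zero then restrict b M (xs zero) else replicate _ false) ⊕ linComb (restrict b M ∘ xs ∘ suc) (c ∘ suc)
    ∎
  where open ≡-Reasoning

countFin-cong : ∀ {m} {p q : Signs m} → p ≗ q → countFin p ≡ countFin q
countFin-cong {zero}  p≗q = refl
countFin-cong {suc m} p≗q = cong₂ _+_ (cong ind (p≗q zero)) (countFin-cong (p≗q ∘ suc))

countFin-true : ∀ m → countFin {m} (λ _ → true) ≡ m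
countFin-true zero    = refl
countFin-true (suc m) = cong suc (countFin-true m)

allFinB-cong : ∀ {t} {p q : Signs t} → p ≗ q → allFinB p ≡ allFinB q
allFinB-cong {zero}  p≗q = refl
allFinB-cong {suc t} p≗q = cong₂ _∧_ (p≗q zero) (allFinB-cong (p≗q ∘ suc))

atomSize-cong : ∀ {t m} {xs ys : Fin t → Vec Bool m} → xs ≗ ys → ∀ s → atomSize xs s ≡ atomSize ys s
atomSize-cong xs≗ys s = countFin-cong (λ i → allFinB-cong (λ j → cong (λ v → eqB (lookup v i) (s j)) (xs≗ys j)))

atomSize-∷ : ∀ {t m} (ys : Fin t → Vec Bool (suc m)) s →
  atomSize ys s ≡ ind (allFinB (λ j → eqB (head (ys j)) (s j))) + atomSize (tail ∘ ys) s
atomSize-∷ ys s = cong₂ _+_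
  (cong ind (allFinB-cong (λ j → cong (λ a → eqB a (s j)) (lookup-zero (ys j)))))
  (countFin-cong (λ i → allFinB-cong (λ j → cong (λ a → eqB a (s j)) (lookup-suc (ys j) i))))
  where
  lookup-zero : ∀ {m} (v : Vec Bool (suc m)) → lookup v zero ≡ head v
  lookup-zero (a ∷ v) = refl
  lookup-suc : ∀ {m} (v : Vec Bool (suc m)) i → lookup v (suc i) ≡ lookup (tail v) i
  lookup-suc (a ∷ v) i = refl

atomSize-restrict : ∀ {t m} b (M : Vec Bool m) (ys : Fin t → Vec Bool m) s →
                    atomSize (M ∷ᶠ ys) (b ∷ᶠ s) ≡ atomSize (restrict b M ∘ ys) s
atomSize-restrict b []      ys s = refl
atomSize-restrict b (a ∷ M) ys s = begin
  atomSize ((a ∷ M) ∷ᶠ ys) (b ∷ᶠ s)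
    ≡⟨ atomSize-∷ ((a ∷ M) ∷ᶠ ys) (b ∷ᶠ s) ⟩
  ind (eqB a b ∧ inHead) + atomSize (tail ∘ ((a ∷ M) ∷ᶠ ys)) (b ∷ᶠ s)
    ≡⟨ cong (ind (eqB a b ∧ inHead) +_) (trans (atomSize-cong tail-∷ (b ∷ᶠ s)) (atomSize-restrict b M (tail ∘ ys) s)) ⟩
  ind (eqB a b ∧ inHead) + atomSize (restrict b M ∘ tail ∘ ys) s
    ≡⟨ head-step ⟩
  atomSize (λ j → restrict b (a ∷ M) (head (ys j) ∷ tail (ys j))) s
    ≡⟨ atomSize-cong (λ j → cong (restrict b (a ∷ M)) (η (ys j))) s ⟨
  atomSize (restrict b (a ∷ M) ∘ ys) s
    ∎
  where
  open ≡-Reasoning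
  inHead = allFinB (λ j → eqB (head (ys j)) (s j))
  tail-∷ : tail ∘ ((a ∷ M) ∷ᶠ ys) ≗ (M ∷ᶠ (tail ∘ ys))
  tail-∷ zero    = refl
  tail-∷ (suc j) = refl
  η : ∀ {m} (v : Vec Bool (suc m)) → v ≡ head v ∷ tail v
  η (_ ∷ _) = refl
  head-step : ind (eqB a b ∧ inHead) + atomSize (restrict b M ∘ tail ∘ ys) s
            ≡ atomSize (λ j → restrict b (a ∷ M) (head (ys j) ∷ tail (ys j))) s
  head-step with eqB a b
  ... | true  = sym (atomSize-∷ (λ j → head (ys j) ∷ restrict b M (tail (ys j))) s)
  ... | false = refl

-- Systems of weight constraints

satisfies : ∀ {t m} → (Fin t → Vec Bool m) → (Signs t → Bool) → (Signs t → ℕ) → Vec Bool m → Bool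
satisfies {t} xs κ β x = allSigns t (λ c → κ c ⇒ᵇ (weight (x ⊕ linComb xs c) ≡ᵇ β c))

solutions : ∀ {t m} → (Fin t → Vec Bool m) → (Signs t → Bool) → (Signs t → ℕ) → ℕ
solutions {m = m} xs κ β = sumVec m (ind ∘ satisfies xs κ β)

size : ∀ {t} → (Signs t → Bool) → ℕ
size {t} κ = sumSigns t (ind ∘ κ)

size-≤ : ∀ {t} (κ : Signs t → Bool) → size κ ≤ 2 ^ t
size-≤ {t} κ = ≤-trans (sumSigns-mono-≤ t (ind≤1 ∘ κ)) (≤-reflexive (trans (sumSigns-const t 1) (*-identityʳ (2 ^ t))))

m+n≡o⇒m≡o∸n : ∀ {m n o} → m + n ≡ o → m ≡ o ∸ n
m+n≡o⇒m≡o∸n {m} {n} refl = sym (m+n∸n≡m m n)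

shared-weight : ∀ {p w₀ w₁ w b₀ b₁} → w₁ + w₀ ≡ p → w₀ + w ≡ b₀ → w₁ + w ≡ b₁ → w ≡ ⌊ b₀ + b₁ ∸ p /2⌋
shared-weight {p} {w₀} {w₁} {w} refl refl refl = begin
  w                                       ≡⟨ n≡⌊n+n/2⌋ w ⟩
  ⌊ w + w /2⌋                             ≡⟨ cong ⌊_/2⌋ (m+n∸m≡n (w₁ + w₀) (w + w)) ⟨
  ⌊ w₁ + w₀ + (w + w) ∸ (w₁ + w₀) /2⌋     ≡⟨ cong (λ s → ⌊ s ∸ (w₁ + w₀) /2⌋) (regroup w₀ w₁ w) ⟩
  ⌊ w₀ + w + (w₁ + w) ∸ (w₁ + w₀) /2⌋     ∎
  where
  open ≡-Reasoning
  regroup : ∀ w₀ w₁ w → w₁ + w₀ + (w + w) ≡ w₀ + w + (w₁ + w)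
  regroup = solve-∀

constraint-split : ∀ k₀ k₁ {p w₀ w₁ w b₀ b₁} → w₁ + w₀ ≡ p →
  T (k₀ ⇒ᵇ (w₀ + w ≡ᵇ b₀)) → T (k₁ ⇒ᵇ (w₁ + w ≡ᵇ b₁)) →
  T ((k₀ ∧ k₁) ⇒ᵇ (w ≡ᵇ ⌊ b₀ + b₁ ∸ p /2⌋)) ×
  T ((k₀ ∨ k₁) ⇒ᵇ (w₀ ≡ᵇ (if k₀ then b₀ ∸ w else p ∸ (b₁ ∸ w))))
constraint-split true  true  {p} {w₀} {w₁} {w} {b₀} {b₁} p≡ e₀ e₁ =
  ≡⇒≡ᵇ w _ (shared-weight p≡ (≡ᵇ⇒≡ (w₀ + w) b₀ e₀) (≡ᵇ⇒≡ (w₁ + w) b₁ e₁)) ,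
  ≡⇒≡ᵇ w₀ _ (m+n≡o⇒m≡o∸n (≡ᵇ⇒≡ (w₀ + w) b₀ e₀))
constraint-split true  false {p} {w₀} {w₁} {w} {b₀} p≡ e₀ e₁ =
  _ , ≡⇒≡ᵇ w₀ _ (m+n≡o⇒m≡o∸n (≡ᵇ⇒≡ (w₀ + w) b₀ e₀))
constraint-split false true  {p} {w₀} {w₁} {w} {b₀} {b₁} p≡ e₀ e₁ = _ , ≡⇒≡ᵇ w₀ _ (begin
  w₀                    ≡⟨ m+n∸m≡n w₁ w₀ ⟨
  w₁ + w₀ ∸ w₁          ≡⟨ cong₂ _∸_ p≡ (m+n≡o⇒m≡o∸n {w₁} {w} (≡ᵇ⇒≡ (w₁ + w) b₁ e₁)) ⟩
  p ∸ (b₁ ∸ w)          ∎)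
  where open ≡-Reasoning
constraint-split false false p≡ e₀ e₁ = _ , _

module Split {t m} (xs : Fin (suc t) → Vec Bool m) (κ : Signs (suc t) → Bool) (β : Signs (suc t) → ℕ) where

  M : Vec Bool m
  M = xs zero

  p q : ℕ
  p = part true M
  q = part false M

  xsP : Fin t → Vec Bool p
  xsP = restrict true M ∘ xs ∘ suc

  xsQ : Fin t → Vec Bool q
  xsQ = restrict false M ∘ xs ∘ suc

  κ₀ κ₁ κ∧ κ∨ : Signs t → Bool
  κ₀ c = κ (false ∷ᶠ c)
  κ₁ c = κ (true ∷ᶠ c)
  κ∧ c = κ₀ c ∧ κ₁ c
  κ∨ c = κ₀ c ∨ κ₁ c

  -- γ c and δ v c are the values of w_Q and w_P forced by the constraints at (0,c) and (1,c).
  β₀ β₁ γ : Signs t → ℕ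
  β₀ c = β (false ∷ᶠ c)
  β₁ c = β (true ∷ᶠ c)
  γ c = ⌊ β₀ c + β₁ c ∸ p /2⌋

  δ : Vec Bool q → Signs t → ℕ
  δ v c = if κ₀ c then β₀ c ∸ weight (v ⊕ linComb xsQ c) else p ∸ (β₁ c ∸ weight (v ⊕ linComb xsQ c))

  restrict-first : ∀ b′ b → restrict b′ M (if b then M else replicate m false) ≡ replicate (part b′ M) (b′ ∧ b)
  restrict-first true  true  = restrict-self true M
  restrict-first false true  = restrict-self false M
  restrict-first true  false = restrict-replicate true M false
  restrict-first false false = restrict-replicate false M false

  restrict-⊕-linComb : ∀ b′ x b c → restrict b′ M (x ⊕ linComb xs (b ∷ᶠ c))
                     ≡ restrict b′ M x ⊕ (replicate (part b′ M) (b′ ∧ b) ⊕ linComb (restrict b′ M ∘ xs ∘ suc) c)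
  restrict-⊕-linComb b′ x b c = begin
    restrict b′ M (x ⊕ ((if b then M else replicate m false) ⊕ linComb (xs ∘ suc) c))
      ≡⟨ restrict-⊕ b′ M x _ ⟩
    restrict b′ M x ⊕ restrict b′ M ((if b then M else replicate m false) ⊕ linComb (xs ∘ suc) c)
      ≡⟨ cong (restrict b′ M x ⊕_) (restrict-⊕ b′ M _ _) ⟩
    restrict b′ M x ⊕ (restrict b′ M (if b then M else replicate m false) ⊕ restrict b′ M (linComb (xs ∘ suc) c))
      ≡⟨ cong₂ (λ y z → restrict b′ M x ⊕ (y ⊕ z)) (restrict-first b′ b) (restrict-linComb b′ M (xs ∘ suc) c) ⟩
    restrict b′ M x ⊕ (replicate (part b′ M) (b′ ∧ b) ⊕ linComb (restrict b′ M ∘ xs ∘ suc) c)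
      ∎
    where open ≡-Reasoning

  weight-split : ∀ x b c → weight (x ⊕ linComb xs (b ∷ᶠ c))
               ≡ weight (restrict true M x ⊕ (replicate p b ⊕ linComb xsP c)) + weight (restrict false M x ⊕ linComb xsQ c)
  weight-split x b c = trans (weight-restrict M _) (cong₂ _+_
    (cong weight (restrict-⊕-linComb true x b c))
    (cong weight (trans (restrict-⊕-linComb false x b c) (cong (restrict false M x ⊕_) (⊕-identityˡ _)))))

  satisfies-split : ∀ x → T (satisfies xs κ β x) →
    T (satisfies xsQ κ∧ γ (restrict false M x)) × T (satisfies xsP κ∨ (δ (restrict false M x)) (restrict true M x))
  satisfies-split x sat with to T-∧ sat
  ... | sat₀ , sat₁ = allSigns-combine t (λ c e₀ e₁ → proj₁ (both c e₀ e₁)) sat₀ sat₁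
                    , allSigns-combine t (λ c e₀ e₁ → proj₂ (both c e₀ e₁)) sat₀ sat₁
    where
    u = restrict true M x
    v = restrict false M x
    w₀ w₁ wQ : Signs t → ℕ
    w₀ c = weight (u ⊕ linComb xsP c)
    w₁ c = weight (u ⊕ (replicate p true ⊕ linComb xsP c))
    wQ c = weight (v ⊕ linComb xsQ c)
    both : ∀ c → T (κ₀ c ⇒ᵇ (weight (x ⊕ linComb xs (false ∷ᶠ c)) ≡ᵇ β₀ c)) →
                 T (κ₁ c ⇒ᵇ (weight (x ⊕ linComb xs (true ∷ᶠ c)) ≡ᵇ β₁ c)) →
                 T (κ∧ c ⇒ᵇ (wQ c ≡ᵇ γ c)) × T (κ∨ c ⇒ᵇ (w₀ c ≡ᵇ δ v c))
    both c e₀ e₁ = constraint-split (κ₀ c) (κ₁ c) {p} {w₀ c} {w₁ c} {wQ c} (weight-⊕-complement u (linComb xsP c))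
      (subst (λ w → T (κ₀ c ⇒ᵇ (w ≡ᵇ β₀ c)))
             (trans (weight-split x false c) (cong (λ y → weight (u ⊕ y) + wQ c) (⊕-identityˡ _))) e₀)
      (subst (λ w → T (κ₁ c ⇒ᵇ (w ≡ᵇ β₁ c))) (weight-split x true c) e₁)

  solutions-split : ∃ λ v → solutions xs κ β ≤ solutions xsP κ∨ (δ v) * solutions xsQ κ∧ γ
  solutions-split with argmax q (λ v → solutions xsP κ∨ (δ v))
  ... | v* , maximal = v* , (begin
    solutions xs κ β
      ≤⟨ sumSigns-mono-≤ m (λ c → ind-≤-* (satisfies-split (tabulate c))) ⟩
    sumVec m (λ x → ind (onQ (restrict false M x)) * ind (onP (restrict false M x) (restrict true M x)))
      ≡⟨ sumVec-restrict M (λ u v → ind (onQ v) * ind (onP v u)) ⟩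
    sumVec q (λ v → sumVec p (λ u → ind (onQ v) * ind (onP v u)))
      ≡⟨ sumSigns-cong q (λ c → sumSigns-*ˡ p (ind (onQ (tabulate c))) _) ⟩
    sumVec q (λ v → ind (onQ v) * solutions xsP κ∨ (δ v))
      ≤⟨ sumSigns-mono-≤ q (λ c → *-monoʳ-≤ (ind (onQ (tabulate c))) (maximal (tabulate c))) ⟩
    sumVec q (λ v → ind (onQ v) * solutions xsP κ∨ (δ v*))
      ≡⟨ sumSigns-cong q (λ c → *-comm (ind (onQ (tabulate c))) _) ⟩
    sumVec q (λ v → solutions xsP κ∨ (δ v*) * ind (onQ v))
      ≡⟨ sumSigns-*ˡ q (solutions xsP κ∨ (δ v*)) _ ⟩
    solutions xsP κ∨ (δ v*) * solutions xsQ κ∧ γ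
      ∎)
    where
    open ≤-Reasoning
    onQ = satisfies xsQ κ∧ γ
    onP = λ v → satisfies xsP κ∨ (δ v)

  size-split : size κ ≡ size κ∧ + size κ∨
  size-split = begin
    sumSigns t (ind ∘ κ₀) + sumSigns t (ind ∘ κ₁)            ≡⟨ sumSigns-+ t (ind ∘ κ₀) (ind ∘ κ₁) ⟨
    sumSigns t (λ c → ind (κ₀ c) + ind (κ₁ c))               ≡⟨ sumSigns-cong t (λ c → ind-+ (κ₀ c) (κ₁ c)) ⟩
    sumSigns t (λ c → ind (κ∧ c) + ind (κ∨ c))               ≡⟨ sumSigns-+ t (ind ∘ κ∧) (ind ∘ κ∨) ⟩
    size κ∧ + size κ∨                                        ∎
    where
    open ≡-Reasoning
    ind-+ : ∀ a b → ind a + ind b ≡ ind (a ∧ b) + ind (a ∨ b)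
    ind-+ true  true  = refl
    ind-+ true  false = refl
    ind-+ false true  = refl
    ind-+ false false = refl

  atomSize-split : ∀ b s → atomSize xs (b ∷ᶠ s) ≡ atomSize (restrict b M ∘ xs ∘ suc) s
  atomSize-split b s = trans (atomSize-cong {xs = xs} {ys = M ∷ᶠ (xs ∘ suc)} (λ { zero → refl ; (suc j) → refl }) (b ∷ᶠ s))
                             (atomSize-restrict b M (xs ∘ suc) s)

square-bound-product : ∀ {X S₁ S₂ n E K₁ K₂ p q} → X ≤ S₁ * S₂ →
  sq S₁ * n ^ K₁ ≤ E ^ K₁ * 4 ^ p → sq S₂ * n ^ K₂ ≤ E ^ K₂ * 4 ^ q →
  sq X * n ^ (K₂ + K₁) ≤ E ^ (K₂ + K₁) * 4 ^ (p + q)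
square-bound-product {X} {S₁} {S₂} {n} {E} {K₁} {K₂} {p} {q} X≤S₁S₂ bound₁ bound₂ = begin
  sq X * n ^ (K₂ + K₁)                        ≤⟨ *-monoˡ-≤ _ (sq-mono-≤ X≤S₁S₂) ⟩
  sq (S₁ * S₂) * n ^ (K₂ + K₁)                ≡⟨ cong (sq (S₁ * S₂) *_) (^-distribˡ-+-* n K₂ K₁) ⟩
  sq (S₁ * S₂) * (n ^ K₂ * n ^ K₁)            ≡⟨ regroup S₁ S₂ (n ^ K₂) (n ^ K₁) ⟩
  (sq S₁ * n ^ K₁) * (sq S₂ * n ^ K₂)         ≤⟨ *-mono-≤ bound₁ bound₂ ⟩
  (E ^ K₁ * 4 ^ p) * (E ^ K₂ * 4 ^ q)         ≡⟨ regroup′ (E ^ K₁) (4 ^ p) (E ^ K₂) (4 ^ q) ⟩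
  (E ^ K₂ * E ^ K₁) * (4 ^ p * 4 ^ q)         ≡⟨ cong₂ _*_ (^-distribˡ-+-* E K₂ K₁) (^-distribˡ-+-* 4 p q) ⟨
  E ^ (K₂ + K₁) * 4 ^ (p + q)                 ∎
  where
  open ≤-Reasoning
  regroup : ∀ a b c d → (a * b) * (a * b) * (c * d) ≡ ((a * a) * d) * ((b * b) * c)
  regroup = solve-∀
  regroup′ : ∀ a b c d → (a * b) * (c * d) ≡ (c * a) * (b * d)
  regroup′ = solve-∀

solutions-bound : ∀ t {m} (xs : Fin t → Vec Bool m) {n A} → (∀ s → n ≤ A * atomSize xs s) →
  ∀ κ β → sq (solutions xs κ β) * n ^ size κ ≤ (4 * A) ^ size κ * 4 ^ m
solutions-bound zero {m} xs {n} {A} atoms κ β with κ []ᶠ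
... | false = ≤-reflexive (begin-equality
  sq (sumVec m (λ _ → 1)) * 1    ≡⟨ *-identityʳ _ ⟩
  sq (sumVec m (λ _ → 1))        ≡⟨ cong sq (trans (sumSigns-const m 1) (*-identityʳ (2 ^ m))) ⟩
  2 ^ m * 2 ^ m                  ≡⟨ 2^m*2^m≡4^m m ⟩
  4 ^ m                          ≡⟨ +-identityʳ (4 ^ m) ⟨
  1 * 4 ^ m                      ∎)
  where open ≤-Reasoning
... | true  = begin
  sq (sumVec m (λ x → ind (weight (x ⊕ replicate m false) ≡ᵇ w))) * (n * 1)
                                   ≡⟨ cong₂ (λ x k → sq x * k) ⊕-zero-drops (*-identityʳ n) ⟩
  sq (countWeight m w) * n         ≤⟨ *-monoʳ-≤ (sq (countWeight m w)) (subst (λ a → n ≤ A * a) (countFin-true m) (atoms []ᶠ)) ⟩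
  sq (countWeight m w) * (A * m)   ≡⟨ regroup (sq (countWeight m w)) A m ⟩
  A * (sq (countWeight m w) * m)   ≤⟨ *-monoʳ-≤ A (countWeight-bound m w) ⟩
  A * (4 * 4 ^ m)                  ≡⟨ regroup′ A (4 ^ m) ⟩
  (4 * A * 1) * 4 ^ m              ∎
  where
  open ≤-Reasoning
  w = β []ᶠ
  ⊕-zero-drops : sumVec m (λ x → ind (weight (x ⊕ replicate m false) ≡ᵇ w)) ≡ countWeight m w
  ⊕-zero-drops = sumSigns-cong m (λ c → cong (λ y → ind (weight y ≡ᵇ w)) (⊕-identityʳ (tabulate c)))
  regroup : ∀ a b c → a * (b * c) ≡ b * (a * c)
  regroup = solve-∀
  regroup′ : ∀ a b → a * (4 * b) ≡ (4 * a * 1) * b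
  regroup′ = solve-∀
solutions-bound (suc t) xs {n} {A} atoms κ β =
  subst₂ (λ K m → sq (solutions xs κ β) * n ^ K ≤ (4 * A) ^ K * 4 ^ m)
         (sym size-split) (part-true+part-false M)
         (square-bound-product {S₁ = solutions xsP κ∨ (δ v)} {S₂ = solutions xsQ κ∧ γ}
                               {K₁ = size κ∨} {K₂ = size κ∧} {p = p} {q = q} split boundP boundQ)
  where
  open Split xs κ β
  v = proj₁ solutions-split
  split = proj₂ solutions-split
  atoms-restrict : ∀ b s → n ≤ A * atomSize (restrict b M ∘ xs ∘ suc) s
  atoms-restrict b s = subst (λ a → n ≤ A * a) (atomSize-split b s) (atoms (b ∷ᶠ s))
  boundP : sq (solutions xsP κ∨ (δ v)) * n ^ size κ∨ ≤ (4 * A) ^ size κ∨ * 4 ^ p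
  boundP = solutions-bound t xsP {n} {A} (atoms-restrict true) κ∨ (δ v)
  boundQ : sq (solutions xsQ κ∧ γ) * n ^ size κ∧ ≤ (4 * A) ^ size κ∧ * 4 ^ q
  boundQ = solutions-bound t xsQ {n} {A} (atoms-restrict false) κ∧ γ

-- The system given by a list of span elements

_≟ᵛ_ : ∀ {m} → DecidableEquality (Vec Bool m)
_≟ᵛ_ = ≡-dec _≟ᵇ_

T-does : ∀ {A : Set} (a? : Dec A) → T (does a?) → A
T-does (yes a) _ = a

selected : ∀ {t m} → (Fin t → Vec Bool m) → List (Vec Bool m) → Signs t → Bool
selected xs Z c = any (λ z → does (z ≟ᵛ linComb xs c)) Z

module _ {t m} (xs : Fin t → Vec Bool m) where

  selected-sound : ∀ (P : Vec Bool m → Bool) Z c → T (allListB P Z) → T (selected xs Z c) → T (P (linComb xs c))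
  selected-sound P (z ∷ Z) c all-P sel with to T-∧ all-P | to T-∨ sel
  ... | Pz , _     | inj₁ hit  = subst (T ∘ P) (T-does (z ≟ᵛ linComb xs c) hit) Pz
  ... | _  , all-P′ | inj₂ sel′ = selected-sound P Z c all-P′ sel′

  selected-miss : ∀ z Z c → All (z ≢_) Z → z ≡ linComb xs c → selected xs Z c ≡ false
  selected-miss z []       c []            z≡ = refl
  selected-miss z (z′ ∷ Z) c (z≢z′ ∷ z≢Z) z≡ =
    cong₂ _∨_ (dec-false (z′ ≟ᵛ linComb xs c) (λ z′≡ → z≢z′ (trans z≡ (sym z′≡)))) (selected-miss z Z c z≢Z z≡)

  length-≤-size : ∀ Z → Unique Z → All (InSpan xs) Z → length Z ≤ size (selected xs Z)
  length-≤-size []       _              _                 = z≤n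
  length-≤-size (z ∷ Z) (z≢Z ∷ unique) ((c , z≡) ∷ inSpan) = begin
    suc (length Z)                                         ≤⟨ +-mono-≤ hit (length-≤-size Z unique inSpan) ⟩
    sumSigns t (ind ∘ isZ) + size (selected xs Z)          ≡⟨ sumSigns-+ t (ind ∘ isZ) (ind ∘ selected xs Z) ⟨
    sumSigns t (λ c → ind (isZ c) + ind (selected xs Z c)) ≡⟨ sumSigns-cong t disjoint ⟩
    size (selected xs (z ∷ Z))                             ∎
    where
    open ≤-Reasoning
    isZ : Signs t → Bool
    isZ c = does (z ≟ᵛ linComb xs c)
    hit : 1 ≤ sumSigns t (ind ∘ isZ)
    hit = ≤-trans (≤-reflexive (cong ind (sym (dec-true (z ≟ᵛ linComb xs c) z≡))))
                  (sumSigns-term t (ind ∘ isZ) (λ c≗c′ → cong (λ w → ind (does (z ≟ᵛ w))) (linComb-cong xs c≗c′)) c)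
    disjoint : ∀ c → ind (isZ c) + ind (selected xs Z c) ≡ ind (isZ c ∨ selected xs Z c)
    disjoint c with z ≟ᵛ linComb xs c
    ... | yes z≡c rewrite selected-miss z Z c z≢Z z≡c = refl
    ... | no  _   = refl

  goodCount-≤-solutions : ∀ n Z → goodCount n Z ≤ solutions xs (selected xs Z) (λ _ → n)
  goodCount-≤-solutions n Z = begin
    goodCount n Z                                  ≡⟨ countList-allVecs m good ⟩
    sumVec m (ind ∘ good)                          ≤⟨ sumSigns-mono-≤ m (λ c → ind-mono (good⇒satisfies (tabulate c))) ⟩
    solutions xs (selected xs Z) (λ _ → n)         ∎
    where
    open ≤-Reasoning
    good : Vec Bool m → Bool
    good x = allListB (λ z → weight (x ⊕ z) ≡ᵇ n) Z
    good⇒satisfies : ∀ x → T (good x) → T (satisfies xs (selected xs Z) (λ _ → n) x)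
    good⇒satisfies x good-x = allSigns-intro t (λ c → ⇒ᵇ-intro (selected-sound (λ z → weight (x ⊕ z) ≡ᵇ n) Z c good-x))

n≤2^n : ∀ n → n ≤ 2 ^ n
n≤2^n zero    = z≤n
n≤2^n (suc n) = begin
  suc n             ≤⟨ s≤s (n≤2^n n) ⟩
  suc (2 ^ n)       ≡⟨ +-comm 1 (2 ^ n) ⟩
  2 ^ n + 1         ≤⟨ +-monoʳ-≤ (2 ^ n) (≤-trans (m^n>0 2 n) (≤-reflexive (sym (+-identityʳ (2 ^ n))))) ⟩
  2 ^ n + (2 ^ n + 0) ∎
  where open ≤-Reasoning

c≤⌊log₂n⌋^[2c] : ∀ {n} c → 4 ≤ n → c ≤ ⌊log₂ n ⌋ ^ (2 * c)
c≤⌊log₂n⌋^[2c] {n} c 4≤n = begin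
  c                    ≤⟨ n≤2^n c ⟩
  2 ^ c                ≤⟨ ^-monoʳ-≤ 2 (m≤n*m c 2) ⟩
  2 ^ (2 * c)          ≤⟨ ^-monoˡ-≤ (2 * c) (subst (_≤ ⌊log₂ n ⌋) (⌊log₂[2^n]⌋≡n 2) (⌊log₂⌋-mono-≤ 4≤n)) ⟩
  ⌊log₂ n ⌋ ^ (2 * c)  ∎
  where open ≤-Reasoning

lemma3p3 : (t : ℕ) → ∃[ C ] ∃[ N ] ((n : ℕ) → N ≤ n →
    (xs : Fin t → Vec Bool (2 * n)) →
    ((s : Fin t → Bool) → n ≤ 2 ^ suc t * atomSize xs s) →
    (Z : List (Vec Bool (2 * n))) → Unique Z → All (InSpan xs) Z →
    goodCount n Z ^ 2 * n ^ length Z ≤ (2 ^ (2 * n)) ^ 2 * ⌊log₂ n ⌋ ^ (2 * C))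
lemma3p3 t = C , 4 , bound
  where
  A = 2 ^ suc t
  C = (4 * A) ^ 2 ^ t
  instance
    4A≢0 : NonZero (4 * A)
    4A≢0 = m*n≢0 4 A ⦃ _ ⦄ ⦃ m^n≢0 2 (suc t) ⦄
  bound : (n : ℕ) → 4 ≤ n → (xs : Fin t → Vec Bool (2 * n)) → (∀ s → n ≤ A * atomSize xs s) →
          (Z : List (Vec Bool (2 * n))) → Unique Z → All (InSpan xs) Z →
          goodCount n Z ^ 2 * n ^ length Z ≤ (2 ^ (2 * n)) ^ 2 * ⌊log₂ n ⌋ ^ (2 * C)
  bound n@(suc _) 4≤n xs atoms Z unique inSpan = begin
    goodCount n Z ^ 2 * n ^ length Z          ≡⟨ cong (λ k → goodCount n Z * k * n ^ length Z) (*-identityʳ _) ⟩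
    sq (goodCount n Z) * n ^ length Z         ≤⟨ *-mono-≤ (sq-mono-≤ (goodCount-≤-solutions xs n Z))
                                                          (^-monoʳ-≤ n (length-≤-size xs Z unique inSpan)) ⟩
    sq (solutions xs κ (λ _ → n)) * n ^ size κ ≤⟨ solutions-bound t xs {n} {A} atoms κ (λ _ → n) ⟩
    (4 * A) ^ size κ * 4 ^ (2 * n)            ≤⟨ *-monoˡ-≤ _ (^-monoʳ-≤ (4 * A) (size-≤ κ)) ⟩
    C * 4 ^ (2 * n)                           ≡⟨ *-comm C _ ⟩
    4 ^ (2 * n) * C                           ≡⟨ cong (_* C) (trans (cong (2 ^ (2 * n) *_) (*-identityʳ _)) (2^m*2^m≡4^m (2 * n))) ⟨
    (2 ^ (2 * n)) ^ 2 * C                     ≤⟨ *-monoʳ-≤ ((2 ^ (2 * n)) ^ 2) (c≤⌊log₂n⌋^[2c] C 4≤n) ⟩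
    (2 ^ (2 * n)) ^ 2 * ⌊log₂ n ⌋ ^ (2 * C)   ∎
    where
    open ≤-Reasoning
    κ = selected xs Z
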